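{- Let $\mathcal{M}^{\le}$ be the set of Dyck paths whose sequence of peak heights (read left to right) is weakly increasing. For a Dyck path $D$ let $|D|$ be its semilength and $\mathrm{sval}(D)$ the number of pairs of consecutive peaks of $D$ at the same height. Writing $[i]_z=1+z+\dots+z^{i-1}$, $$\sum_{D\in\mathcal{M}^{\le}}s^{\mathrm{sval}(D)}z^{|D|}=1+\sum_{a\ge1}\frac{z^a}{1-sz[a]_z}\prod_{i=1}^{a-1}\frac{1+(1-s)z[i]_z}{1-sz[i]_z}.$$
   Context: A Dyck path of semilength $n$ is a lattice path with steps $\mathbf{u}=(1,1)$ and $\mathbf{d}=(1,-1)$ from $(0,0)$ to $(2n,0)$ never going below the $x$-axis. A peak is an occurrence of consecutive steps $\mathbf{ud}$; its height is the $y$-coordinate of its highest vertex. Two peaks are consecutive if no other peak lies between them. -}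

module Defs where

open import Data.Bool using (Bool; true; false; _∧_; if_then_else_)
open import Data.Nat using (ℕ; zero; suc; _∸_; _≡ᵇ_; _<ᵇ_; _≤ᵇ_) renaming (_+_ to _+ℕ_; _*_ to _*ℕ_)
open import Data.Integer using (ℤ; +_; _+_; _*_; -_; 0ℤ; 1ℤ)
open import Data.List using (List; []; _∷_; _++_; map; filter; length)
open import Relation.Nullary.Decidable using (Dec; yes; no)
open import Data.Bool.Properties using () renaming (_≟_ to _≟B_)

data Step : Set where
  u d : Step

words : ℕ → List (List Step)
words zero = [] ∷ []
words (suc m) = map (u ∷_) (words m) ++ map (d ∷_) (words m)

dyckFrom : ℕ → List Step → Bool
dyckFrom h [] = h ≡ᵇ 0
dyckFrom h (u ∷ w) = dyckFrom (suc h) w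
dyckFrom zero (d ∷ w) = false
dyckFrom (suc h) (d ∷ w) = dyckFrom h w

isDyck : List Step → Bool
isDyck = dyckFrom 0

peaksFrom : ℕ → List Step → List ℕ
peaksFrom h [] = []
peaksFrom h (u ∷ d ∷ w) = suc h ∷ peaksFrom h w
peaksFrom h (u ∷ w) = peaksFrom (suc h) w
peaksFrom h (d ∷ w) = peaksFrom (h ∸ 1) w

peakHeights : List Step → List ℕ
peakHeights = peaksFrom 0

weaklyIncreasing : List ℕ → Bool
weaklyIncreasing [] = true
weaklyIncreasing (x ∷ []) = true
weaklyIncreasing (x ∷ y ∷ xs) = (x ≤ᵇ y) ∧ weaklyIncreasing (y ∷ xs)

equalConsecutive : List ℕ → ℕ
equalConsecutive [] = 0
equalConsecutive (x ∷ []) = 0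
equalConsecutive (x ∷ y ∷ xs) = (if x ≡ᵇ y then 1 else 0) +ℕ equalConsecutive (y ∷ xs)

sval : List Step → ℕ
sval w = equalConsecutive (peakHeights w)

inMle : List Step → Bool
inMle w = isDyck w ∧ weaklyIncreasing (peakHeights w)

-- number of D ∈ M^≤ with |D| = n and sval(D) = k
-- (coefficient of s^k z^n of the left-hand side)
lhsCoeff : ℕ → ℕ → ℕ
lhsCoeff n k = length (filter (λ w → (inMle w ∧ (sval w ≡ᵇ k)) ≟B true) (words (2 *ℕ n)))

-- Formal power series in z with coefficients polynomials in s, over ℤ:
-- f n k = coefficient of z^n s^k.

Ser : Set
Ser = ℕ → ℕ → ℤ

sumTo : ℕ → (ℕ → ℤ) → ℤ
sumTo zero f = f 0
sumTo (suc n) f = sumTo n f + f (suc n)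

oneS : Ser
oneS n k = if (n ≡ᵇ 0) ∧ (k ≡ᵇ 0) then 1ℤ else 0ℤ

zS : Ser
zS n k = if (n ≡ᵇ 1) ∧ (k ≡ᵇ 0) then 1ℤ else 0ℤ

sS : Ser
sS n k = if (n ≡ᵇ 0) ∧ (k ≡ᵇ 1) then 1ℤ else 0ℤ

_⊕_ : Ser → Ser → Ser
(f ⊕ g) n k = f n k + g n k

⊝_ : Ser → Ser
(⊝ f) n k = - f n k

_⊗_ : Ser → Ser → Ser
(f ⊗ g) n k = sumTo n (λ i → sumTo k (λ j → f i j * g (n ∸ i) (k ∸ j)))

infixl 6 _⊕_
infixl 7 _⊗_

powS : Ser → ℕ → Ser
powS f zero = oneS
powS f (suc m) = f ⊗ powS f m

-- 1/(1 - f) = Σ_m f^m, for f with zero constant term in z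
-- (then f^m contributes only to z-degrees ≥ m, so the sum is finite coefficientwise)
geom : Ser → Ser
geom f n k = sumTo n (λ m → powS f m n k)

qint : ℕ → Ser
qint i n k = if (n <ᵇ i) ∧ (k ≡ᵇ 0) then 1ℤ else 0ℤ

prodFrom1 : ℕ → (ℕ → Ser) → Ser
prodFrom1 zero f = oneS
prodFrom1 (suc m) f = prodFrom1 m f ⊗ f (suc m)

factor : ℕ → Ser
factor i = (oneS ⊕ (oneS ⊕ ⊝ sS) ⊗ zS ⊗ qint i) ⊗ geom (sS ⊗ zS ⊗ qint i)

summand : ℕ → Ser
summand a = powS zS a ⊗ geom (sS ⊗ zS ⊗ qint a) ⊗ prodFrom1 (a ∸ 1) factor

-- right-hand side: 1 + Σ_{a ≥ 1} summand a; the summand for a is divisible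
-- by z^a, so the coefficient of z^n only involves a ≤ n.
rhs : Ser
rhs n k = oneS n k + sumTo n (λ a → if a ≡ᵇ 0 then 0ℤ else summand a n k)

module Submission where

-- Read a path from left to right and count its completions given the current height h and the
-- height p of the last peak so far: A p h is their generating function, B p h that of the
-- completions starting with an up step.  Splitting off the first steps gives linear equations
-- between these series in which p only enters through its comparison with the height h + 1 of
-- the next peak.  For B₀ q = B 0 q and the series afterPeak q = A (q + 1) q they reduce to
--   B₀ q = z B₀ (q + 1) + afterPeak q,    afterPeak q = 1 + z [q + 1] (z B₀ (q + 1) + s afterPeak q),
-- the second because after a peak of height q + 1 the path descends to some height h ≤ q and the
-- next peak, of height ≥ q + 1, needs the full climb.  Solving the second equation for afterPeak q
-- turns Y q = z^(q+1) B₀ q into Y q = z^(q+1) / (1 - s z [q + 1]) + factor (q + 1) · Y (q + 1), and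
-- unrolling this from Y 0 = A 0 0 - 1 gives the formula: after N steps the remainder is O(z^(N+1)).

open import Defs
open import Level using (0ℓ)
open import Algebra using (CommutativeRing)
open import Data.Nat using (ℕ; zero; suc; _∸_; _≤_; _<_; z≤n; s≤s)
open import Data.Nat.Properties using (≤-refl; m≤n⇒m≤1+n; m∸n≤m; ≤-<-trans; m∸[m∸n]≡n; ∸-+-assoc; m+[n∸m]≡n)
open import Data.Product using (_,_)
open import Data.Integer using (+_)
open import Relation.Binary.PropositionalEquality as ≡ using (_≡_)
import Algebra.Construct.Pointwise as Pointwise
import Algebra.Properties.CommutativeSemigroup as CommutativeSemigroupProperties
import Relation.Binary.Reasoning.Setoid as ≈-Reasoning

module PowerSeries {c ℓ} (R : CommutativeRing c ℓ) where

  open CommutativeRing R hiding (zero)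
  open CommutativeSemigroupProperties +-commutativeSemigroup using (interchange)
  open ≈-Reasoning setoid

  Series : Set c
  Series = ℕ → Carrier

  Σ≤ : ℕ → (ℕ → Carrier) → Carrier
  Σ≤ zero    f = f 0
  Σ≤ (suc n) f = Σ≤ n f + f (suc n)

  Σ≤-cong : ∀ n {f g} → (∀ {i} → i ≤ n → f i ≈ g i) → Σ≤ n f ≈ Σ≤ n g
  Σ≤-cong zero    f≈g = f≈g z≤n
  Σ≤-cong (suc n) f≈g = +-cong (Σ≤-cong n (λ i≤n → f≈g (m≤n⇒m≤1+n i≤n))) (f≈g ≤-refl)

  Σ≤-zero : ∀ n {f} → (∀ {i} → i ≤ n → f i ≈ 0#) → Σ≤ n f ≈ 0#
  Σ≤-zero zero    f≈0 = f≈0 z≤n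
  Σ≤-zero (suc n) f≈0 = trans (+-cong (Σ≤-zero n (λ i≤n → f≈0 (m≤n⇒m≤1+n i≤n))) (f≈0 ≤-refl)) (+-identityʳ 0#)

  Σ≤-suc : ∀ n f → Σ≤ (suc n) f ≈ f 0 + Σ≤ n (λ i → f (suc i))
  Σ≤-suc zero    f = refl
  Σ≤-suc (suc n) f = trans (+-congʳ (Σ≤-suc n f)) (+-assoc _ _ _)

  Σ≤-distrib-+ : ∀ n f g → Σ≤ n (λ i → f i + g i) ≈ Σ≤ n f + Σ≤ n g
  Σ≤-distrib-+ zero    f g = refl
  Σ≤-distrib-+ (suc n) f g = trans (+-congʳ (Σ≤-distrib-+ n f g)) (interchange _ _ _ _)

  *-distribˡ-Σ≤ : ∀ n a f → a * Σ≤ n f ≈ Σ≤ n (λ i → a * f i)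
  *-distribˡ-Σ≤ zero    a f = refl
  *-distribˡ-Σ≤ (suc n) a f = trans (distribˡ a _ _) (+-congʳ (*-distribˡ-Σ≤ n a f))

  *-distribʳ-Σ≤ : ∀ n a f → Σ≤ n f * a ≈ Σ≤ n (λ i → f i * a)
  *-distribʳ-Σ≤ zero    a f = refl
  *-distribʳ-Σ≤ (suc n) a f = trans (distribʳ a _ _) (+-congʳ (*-distribʳ-Σ≤ n a f))

  Σ≤-reverse : ∀ n f → Σ≤ n f ≈ Σ≤ n (λ i → f (n ∸ i))
  Σ≤-reverse zero    f = refl
  Σ≤-reverse (suc n) f = begin
    Σ≤ n f + f (suc n)                 ≈⟨ +-congʳ (Σ≤-reverse n f) ⟩
    Σ≤ n (λ i → f (n ∸ i)) + f (suc n) ≈⟨ +-comm _ _ ⟩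
    f (suc n) + Σ≤ n (λ i → f (n ∸ i)) ≈⟨ Σ≤-suc n (λ i → f (suc n ∸ i)) ⟨
    Σ≤ (suc n) (λ i → f (suc n ∸ i))   ∎

  -- Both sides sum H i j over the triangle i + j ≤ n.
  Σ≤-triangle : ∀ n (H : ℕ → ℕ → Carrier) →
                Σ≤ n (λ i → Σ≤ (n ∸ i) (H i)) ≈ Σ≤ n (λ m → Σ≤ m (λ i → H i (m ∸ i)))
  Σ≤-triangle zero    H = refl
  Σ≤-triangle (suc n) H = begin
    Σ≤ (suc n) (λ i → Σ≤ (suc n ∸ i) (H i))
      ≈⟨ Σ≤-suc n _ ⟩
    Σ≤ (suc n) (H 0) + Σ≤ n (λ i → Σ≤ (n ∸ i) (H (suc i)))
      ≈⟨ +-cong (Σ≤-suc n (H 0)) (Σ≤-triangle n (λ i → H (suc i))) ⟩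
    (H 0 0 + Σ≤ n (λ j → H 0 (suc j))) + Σ≤ n (λ m → Σ≤ m (λ i → H (suc i) (m ∸ i)))
      ≈⟨ +-assoc _ _ _ ⟩
    H 0 0 + (Σ≤ n (λ j → H 0 (suc j)) + Σ≤ n (λ m → Σ≤ m (λ i → H (suc i) (m ∸ i))))
      ≈⟨ +-congˡ (Σ≤-distrib-+ n _ _) ⟨
    H 0 0 + Σ≤ n (λ m → H 0 (suc m) + Σ≤ m (λ i → H (suc i) (m ∸ i)))
      ≈⟨ +-congˡ (Σ≤-cong n (λ {m} _ → Σ≤-suc m (λ i → H i (suc m ∸ i)))) ⟨
    H 0 0 + Σ≤ n (λ m → Σ≤ (suc m) (λ i → H i (suc m ∸ i)))
      ≈⟨ Σ≤-suc n _ ⟨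
    Σ≤ (suc n) (λ m → Σ≤ m (λ i → H i (m ∸ i))) ∎

  infix  4 _≈ˢ_
  infixl 6 _+ˢ_
  infixl 7 _*ˢ_

  _≈ˢ_ : Series → Series → Set ℓ
  f ≈ˢ g = ∀ n → f n ≈ g n

  _+ˢ_ : Series → Series → Series
  (f +ˢ g) n = f n + g n

  -ˢ_ : Series → Series
  (-ˢ f) n = - f n

  0ˢ : Series
  0ˢ _ = 0#

  _*ˢ_ : Series → Series → Series
  (f *ˢ g) n = Σ≤ n (λ i → f i * g (n ∸ i))

  constant : Carrier → Series
  constant a zero    = a
  constant a (suc _) = 0#

  1ˢ : Series
  1ˢ = constant 1#

  shift : Series → Series
  shift f zero    = 0#
  shift f (suc n) = f n

  *ˢ-cong : ∀ {f f′ g g′} → f ≈ˢ f′ → g ≈ˢ g′ → f *ˢ g ≈ˢ f′ *ˢ g′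
  *ˢ-cong f≈f′ g≈g′ n = Σ≤-cong n (λ {i} _ → *-cong (f≈f′ i) (g≈g′ (n ∸ i)))

  *ˢ-comm : ∀ f g → f *ˢ g ≈ˢ g *ˢ f
  *ˢ-comm f g n = begin
    Σ≤ n (λ i → f i * g (n ∸ i))             ≈⟨ Σ≤-reverse n _ ⟩
    Σ≤ n (λ i → f (n ∸ i) * g (n ∸ (n ∸ i))) ≈⟨ Σ≤-cong n (λ i≤n → trans (*-comm _ _) (*-congʳ (reflexive (≡.cong g (m∸[m∸n]≡n i≤n))))) ⟩
    Σ≤ n (λ i → g i * f (n ∸ i))             ∎

  *ˢ-assoc : ∀ f g h → (f *ˢ g) *ˢ h ≈ˢ f *ˢ (g *ˢ h)
  *ˢ-assoc f g h n = sym (begin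
    Σ≤ n (λ i → f i * Σ≤ (n ∸ i) (λ j → g j * h (n ∸ i ∸ j)))
      ≈⟨ Σ≤-cong n (λ {i} _ → *-distribˡ-Σ≤ (n ∸ i) (f i) _) ⟩
    Σ≤ n (λ i → Σ≤ (n ∸ i) (λ j → f i * (g j * h (n ∸ i ∸ j))))
      ≈⟨ Σ≤-triangle n _ ⟩
    Σ≤ n (λ m → Σ≤ m (λ i → f i * (g (m ∸ i) * h (n ∸ i ∸ (m ∸ i)))))
      ≈⟨ Σ≤-cong n (λ {m} _ → Σ≤-cong m (λ i≤m → trans (sym (*-assoc _ _ _)) (*-congˡ (reflexive (≡.cong h (cancel i≤m)))))) ⟩
    Σ≤ n (λ m → Σ≤ m (λ i → (f i * g (m ∸ i)) * h (n ∸ m)))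
      ≈⟨ Σ≤-cong n (λ {m} _ → *-distribʳ-Σ≤ m _ _) ⟨
    Σ≤ n (λ m → Σ≤ m (λ i → f i * g (m ∸ i)) * h (n ∸ m)) ∎)
    where
    cancel : ∀ {i m} → i ≤ m → n ∸ i ∸ (m ∸ i) ≡ n ∸ m
    cancel {i} {m} i≤m = ≡.trans (∸-+-assoc n i (m ∸ i)) (≡.cong (n ∸_) (m+[n∸m]≡n i≤m))

  *ˢ-distribˡ-+ˢ : ∀ f g h → f *ˢ (g +ˢ h) ≈ˢ f *ˢ g +ˢ f *ˢ h
  *ˢ-distribˡ-+ˢ f g h n = trans (Σ≤-cong n (λ _ → distribˡ _ _ _)) (Σ≤-distrib-+ n _ _)

  constant-*ˢ : ∀ a g → constant a *ˢ g ≈ˢ (λ n → a * g n)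
  constant-*ˢ a g zero    = refl
  constant-*ˢ a g (suc n) = begin
    Σ≤ (suc n) (λ i → constant a i * g (suc n ∸ i)) ≈⟨ Σ≤-suc n _ ⟩
    a * g (suc n) + Σ≤ n (λ i → 0# * g (n ∸ i))      ≈⟨ +-congˡ (Σ≤-zero n (λ _ → zeroˡ _)) ⟩
    a * g (suc n) + 0#                               ≈⟨ +-identityʳ _ ⟩
    a * g (suc n)                                    ∎

  powerSeriesRing : CommutativeRing c ℓ
  powerSeriesRing = record
    { Carrier = Series ; _≈_ = _≈ˢ_ ; _+_ = _+ˢ_ ; _*_ = _*ˢ_ ; -_ = -ˢ_ ; 0# = 0ˢ ; 1# = 1ˢ
    ; isCommutativeRing = record
      { isRing = record
        { +-isAbelianGroup = Pointwise.isAbelianGroup ℕ +-isAbelianGroup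
        ; *-cong           = *ˢ-cong
        ; *-assoc          = *ˢ-assoc
        ; *-identity       = identityˡ , λ f n → trans (*ˢ-comm f 1ˢ n) (identityˡ f n)
        ; distrib          = *ˢ-distribˡ-+ˢ , λ h f g n →
            trans (*ˢ-comm (f +ˢ g) h n) (trans (*ˢ-distribˡ-+ˢ h f g n) (+-cong (*ˢ-comm h f n) (*ˢ-comm h g n)))
        }
      ; *-comm = *ˢ-comm
      }
    }
    where
    identityˡ : ∀ g → 1ˢ *ˢ g ≈ˢ g
    identityˡ g n = trans (constant-*ˢ 1# g n) (*-identityˡ (g n))

  shift-*ˢ : ∀ f g → shift f *ˢ g ≈ˢ shift (f *ˢ g)
  shift-*ˢ f g zero    = zeroˡ _
  shift-*ˢ f g (suc n) = trans (Σ≤-suc n _) (trans (+-congʳ (zeroˡ _)) (+-identityˡ _))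

  x : Series
  x = shift 1ˢ

  x-*ˢ : ∀ g → x *ˢ g ≈ˢ shift g
  x-*ˢ g zero    = shift-*ˢ 1ˢ g zero
  x-*ˢ g (suc n) = trans (shift-*ˢ 1ˢ g (suc n)) (trans (constant-*ˢ 1# g n) (*-identityˡ _))

  *ˢ-congˡ-upTo : ∀ f {g g′} n → (∀ {i} → i ≤ n → g i ≈ g′ i) → (f *ˢ g) n ≈ (f *ˢ g′) n
  *ˢ-congˡ-upTo f n g≈g′ = Σ≤-cong n (λ {i} _ → *-congˡ (g≈g′ (m∸n≤m n i)))

  VanishesBelow : ℕ → Series → Set ℓ
  VanishesBelow m f = ∀ {n} → n < m → f n ≈ 0#

  *ˢ-vanishesˡ : ∀ {m f} g → VanishesBelow m f → VanishesBelow m (f *ˢ g)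
  *ˢ-vanishesˡ g f≈0 {n} n<m = Σ≤-zero n (λ i≤n → trans (*-congʳ (f≈0 (≤-<-trans i≤n n<m))) (zeroˡ _))

  *ˢ-vanishes-suc : ∀ {m f g} → VanishesBelow 1 f → VanishesBelow m g → VanishesBelow (suc m) (f *ˢ g)
  *ˢ-vanishes-suc f≈0 g≈0 {n} n<1+m = Σ≤-zero n term
    where
    term : ∀ {i} → i ≤ n → _
    term {zero}  _      = trans (*-congʳ (f≈0 (s≤s z≤n))) (zeroˡ _)
    term {suc i} 1+i≤n  = trans (*-congˡ (g≈0 (below 1+i≤n n<1+m))) (zeroʳ _)
      where
      below : ∀ {n m} → suc i ≤ n → n < suc m → n ∸ suc i < m
      below {suc n} _ (s≤s n<m) = ≤-<-trans (m∸n≤m n i) n<m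

module BivariateSeries where

  open import Algebra using (RawRing)
  open import Algebra.Morphism.Structures using (IsRingMonomorphism)
  import Algebra.Morphism.RingMonomorphism as RingMonomorphism
  open import Data.Integer using (0ℤ; _+_)
  open import Data.Integer.Properties using (+-*-commutativeRing)
  open import Function using (id)

  module ℤ⟦s⟧ = PowerSeries +-*-commutativeRing
  module ℤ⟦s⟧⟦z⟧ = PowerSeries ℤ⟦s⟧.powerSeriesRing

  open ℤ⟦s⟧⟦z⟧ using (_≈ˢ_; _*ˢ_; 1ˢ)

  zeroSer : Ser
  zeroSer _ _ = 0ℤ

  sumTo≡Σ≤ : ∀ n f → sumTo n f ≡ ℤ⟦s⟧.Σ≤ n f
  sumTo≡Σ≤ zero    f = ≡.refl
  sumTo≡Σ≤ (suc n) f = ≡.cong (_+ f (suc n)) (sumTo≡Σ≤ n f)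

  Σ≤-apply : ∀ n (h : ℕ → ℤ⟦s⟧.Series) k → ℤ⟦s⟧⟦z⟧.Σ≤ n h k ≡ ℤ⟦s⟧.Σ≤ n (λ i → h i k)
  Σ≤-apply zero    h k = ≡.refl
  Σ≤-apply (suc n) h k = ≡.cong (_+ h (suc n) k) (Σ≤-apply n h k)

  ⊗≈*ˢ : ∀ f g → f ⊗ g ≈ˢ f *ˢ g
  ⊗≈*ˢ f g n k = ≡.trans (sumTo≡Σ≤ n _) (≡.trans (ℤ⟦s⟧.Σ≤-cong n (λ {i} _ → sumTo≡Σ≤ k _)) (≡.sym (Σ≤-apply n _ k)))

  oneS≈1ˢ : oneS ≈ˢ 1ˢ
  oneS≈1ˢ zero    zero    = ≡.refl
  oneS≈1ˢ zero    (suc k) = ≡.refl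
  oneS≈1ˢ (suc n) k       = ≡.refl

  rawSerRing : RawRing 0ℓ 0ℓ
  rawSerRing = record
    { _≈_ = _≈ˢ_ ; _+_ = _⊕_ ; _*_ = _⊗_ ; -_ = ⊝_ ; 0# = zeroSer ; 1# = oneS }

  -- ⊗ agrees with the iterated convolution *ˢ, so the ring laws transfer along the identity map.
  id-isRingMonomorphism : IsRingMonomorphism rawSerRing (CommutativeRing.rawRing ℤ⟦s⟧⟦z⟧.powerSeriesRing) id
  id-isRingMonomorphism = record
    { isRingHomomorphism = record
      { isSemiringHomomorphism = record
        { isNearSemiringHomomorphism = record
          { +-isMonoidHomomorphism = record
            { isMagmaHomomorphism = record
              { isRelHomomorphism = record { cong = id }
              ; homo = λ _ _ _ _ → ≡.refl }
            ; ε-homo = λ _ _ → ≡.refl }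
          ; *-homo = ⊗≈*ˢ }
        ; 1#-homo = oneS≈1ˢ }
      ; -‿homo = λ _ _ _ → ≡.refl }
    ; injective = id }

  serRing : CommutativeRing 0ℓ 0ℓ
  serRing = record
    { isCommutativeRing = RingMonomorphism.isCommutativeRing id-isRingMonomorphism
                            (CommutativeRing.isCommutativeRing ℤ⟦s⟧⟦z⟧.powerSeriesRing) }

module SeriesLemmas where

  open BivariateSeries
  open import Data.Integer using (_+_)
  import Data.Integer.Properties as ℤ
  open import Data.Nat.Properties using (≤′⇒≤; ≤⇒≤′)
  open import Data.Nat using (_≤′_; ≤′-refl; ≤′-step)
  open import Algebra.Solver.Ring.NaturalCoefficients.Default (CommutativeRing.commutativeSemiring serRing)
    using (solve; _:+_; _:*_; _:=_)

  open CommutativeRing serRing public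
    using (_≈_; refl; sym; trans; distribˡ; -‿cong; +-comm; +-cong; +-identityˡ; +-identityʳ; +-congˡ; +-congʳ; *-congˡ; *-congʳ; *-assoc; *-comm; *-identityˡ; *-identityʳ; setoid)
  open ℤ⟦s⟧⟦z⟧ public using (shift; VanishesBelow)
  open import Algebra.Properties.Ring (CommutativeRing.ring serRing) using ([y-z]x≈yx-zx)
  open import Algebra.Properties.AbelianGroup (CommutativeRing.+-abelianGroup serRing) using (xyx⁻¹≈y)

  zS≈x : zS ≈ ℤ⟦s⟧⟦z⟧.x
  zS≈x zero          k       = ≡.refl
  zS≈x (suc zero)    zero    = ≡.refl
  zS≈x (suc zero)    (suc k) = ≡.refl
  zS≈x (suc (suc n)) k       = ≡.refl

  sS≈constant-x : sS ≈ ℤ⟦s⟧⟦z⟧.constant ℤ⟦s⟧.x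
  sS≈constant-x zero    zero          = ≡.refl
  sS≈constant-x zero    (suc zero)    = ≡.refl
  sS≈constant-x zero    (suc (suc k)) = ≡.refl
  sS≈constant-x (suc n) k             = ≡.refl

  zS-⊗ : ∀ f → zS ⊗ f ≈ shift f
  zS-⊗ f = trans (⊗≈*ˢ zS f) (trans (ℤ⟦s⟧⟦z⟧.*ˢ-cong zS≈x (refl {f})) (ℤ⟦s⟧⟦z⟧.x-*ˢ f))

  sS-⊗ : ∀ f → sS ⊗ f ≈ λ n → ℤ⟦s⟧.shift (f n)
  sS-⊗ f = trans (⊗≈*ˢ sS f) (trans (ℤ⟦s⟧⟦z⟧.*ˢ-cong sS≈constant-x (refl {f}))
             (trans (ℤ⟦s⟧⟦z⟧.constant-*ˢ ℤ⟦s⟧.x f) (λ n → ℤ⟦s⟧.x-*ˢ (f n))))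

  qint-1 : qint 1 ≈ oneS
  qint-1 zero    zero    = ≡.refl
  qint-1 zero    (suc k) = ≡.refl
  qint-1 (suc n) k       = ≡.refl

  qint-suc : ∀ i → qint (suc i) ≈ oneS ⊕ zS ⊗ qint i
  qint-suc i = trans split (+-congˡ {oneS} (sym (zS-⊗ (qint i))))
    where
    split : qint (suc i) ≈ oneS ⊕ shift (qint i)
    split zero    zero    = ≡.refl
    split zero    (suc k) = ≡.refl
    split (suc n) k       = ≡.sym (ℤ.+-identityˡ _)

  zS-⊗-qint-suc : ∀ i → zS ⊗ qint (suc i) ≈ zS ⊕ zS ⊗ (zS ⊗ qint i)
  zS-⊗-qint-suc i = trans (*-congˡ {zS} (qint-suc i)) (trans (distribˡ zS oneS (zS ⊗ qint i)) (+-congʳ {zS ⊗ (zS ⊗ qint i)} (*-identityʳ zS)))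

  ⊗-congˡ-upTo : ∀ f {g g′} n → (∀ {i} → i ≤ n → g i ℤ⟦s⟧.≈ˢ g′ i) → (f ⊗ g) n ℤ⟦s⟧.≈ˢ (f ⊗ g′) n
  ⊗-congˡ-upTo f {g} {g′} n g≈g′ k =
    ≡.trans (⊗≈*ˢ f g n k) (≡.trans (ℤ⟦s⟧⟦z⟧.*ˢ-congˡ-upTo f n g≈g′ k) (≡.sym (⊗≈*ˢ f g′ n k)))

  ⊗-vanishesˡ : ∀ {m f} g → VanishesBelow m f → VanishesBelow m (f ⊗ g)
  ⊗-vanishesˡ {f = f} g f≈0 {n} n<m k = ≡.trans (⊗≈*ˢ f g n k) (ℤ⟦s⟧⟦z⟧.*ˢ-vanishesˡ g f≈0 n<m k)

  powS-vanishes : ∀ {c} → VanishesBelow 1 c → ∀ m → VanishesBelow m (powS c m)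
  powS-vanishes c≈0 zero    ()
  powS-vanishes {c} c≈0 (suc m) {n} n<m k =
    ≡.trans (⊗≈*ˢ c (powS c m) n k) (ℤ⟦s⟧⟦z⟧.*ˢ-vanishes-suc c≈0 (powS-vanishes c≈0 m) n<m k)

  geomUpTo : ℕ → Ser → Ser
  geomUpTo zero    c = oneS
  geomUpTo (suc N) c = geomUpTo N c ⊕ powS c (suc N)

  geom≡geomUpTo : ∀ c n k → geom c n k ≡ geomUpTo n c n k
  geom≡geomUpTo c n k = ≡.sym (unfold n)
    where
    unfold : ∀ N → geomUpTo N c n k ≡ sumTo N (λ m → powS c m n k)
    unfold zero    = ≡.refl
    unfold (suc N) = ≡.cong (_+ powS c (suc N) n k) (unfold N)

  geomUpTo-stable : ∀ {c N n} → VanishesBelow 1 c → n ≤′ N → geomUpTo N c n ℤ⟦s⟧.≈ˢ geomUpTo n c n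
  geomUpTo-stable c≈0 ≤′-refl              k = ≡.refl
  geomUpTo-stable {c} {n = n} c≈0 (≤′-step {N} n≤N) k =
    ≡.trans (≡.cong (λ t → geomUpTo N c n k + t) (powS-vanishes c≈0 (suc N) (s≤s (≤′⇒≤ n≤N)) k))
            (≡.trans (ℤ.+-identityʳ _) (geomUpTo-stable {n = n} c≈0 n≤N k))

  geomUpTo-suc : ∀ c N → c ⊗ geomUpTo N c ⊕ oneS ≈ geomUpTo (suc N) c
  geomUpTo-suc c zero    = +-comm (c ⊗ oneS) oneS
  geomUpTo-suc c (suc N) = trans (regroup c (geomUpTo N c) (powS c (suc N)) oneS) (+-congʳ {c ⊗ powS c (suc N)} (geomUpTo-suc c N))
    where
    regroup : ∀ c g p o → c ⊗ (g ⊕ p) ⊕ o ≈ (c ⊗ g ⊕ o) ⊕ c ⊗ p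
    regroup = solve 4 (λ c g p o → c :* (g :+ p) :+ o := (c :* g :+ o) :+ c :* p) refl

  -- Only c⁰, …, cⁿ contribute to the coefficient of zⁿ, so geom c may be truncated there.
  geom-fixedPoint : ∀ {c} → VanishesBelow 1 c → c ⊗ geom c ⊕ oneS ≈ geom c
  geom-fixedPoint {c} c≈0 n k = begin
    (c ⊗ geom c) n k + oneS n k           ≡⟨ ≡.cong (_+ oneS n k) (⊗-congˡ-upTo c n truncate k) ⟩
    (c ⊗ geomUpTo n c ⊕ oneS) n k         ≡⟨ geomUpTo-suc c n n k ⟩
    geomUpTo (suc n) c n k                ≡⟨ geomUpTo-stable {n = n} c≈0 (≤′-step ≤′-refl) k ⟩
    geomUpTo n c n k                      ≡⟨ geom≡geomUpTo c n k ⟨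
    geom c n k                            ∎
    where
    open ≡.≡-Reasoning
    truncate : ∀ {i} → i ≤ n → geom c i ℤ⟦s⟧.≈ˢ geomUpTo n c i
    truncate {i} i≤n k = ≡.trans (geom≡geomUpTo c i k) (≡.sym (geomUpTo-stable {n = i} c≈0 (≤⇒≤′ i≤n) k))

  oneS-⊝-⊗ : ∀ c x → (oneS ⊕ ⊝ c) ⊗ x ≈ x ⊕ ⊝ (c ⊗ x)
  oneS-⊝-⊗ c x = trans ([y-z]x≈yx-zx x oneS c) (+-congʳ {⊝ (c ⊗ x)} (*-identityˡ x))

  geom-inverse : ∀ {c} → VanishesBelow 1 c → (oneS ⊕ ⊝ c) ⊗ geom c ≈ oneS
  geom-inverse {c} c≈0 = begin
    (oneS ⊕ ⊝ c) ⊗ geom c               ≈⟨ oneS-⊝-⊗ c (geom c) ⟩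
    geom c ⊕ ⊝ (c ⊗ geom c)             ≈⟨ +-congʳ {⊝ (c ⊗ geom c)} (geom-fixedPoint c≈0) ⟨
    c ⊗ geom c ⊕ oneS ⊕ ⊝ (c ⊗ geom c)  ≈⟨ xyx⁻¹≈y (c ⊗ geom c) oneS ⟩
    oneS                                ∎
    where open ≈-Reasoning setoid

  linear-solution : ∀ {c x a} → VanishesBelow 1 c → x ≈ c ⊗ x ⊕ a → x ≈ geom c ⊗ a
  linear-solution {c} {x} {a} c≈0 x≈cx+a = begin
    x                                ≈⟨ *-identityˡ x ⟨
    oneS ⊗ x                         ≈⟨ *-congʳ {x} (trans (*-comm (geom c) (oneS ⊕ ⊝ c)) (geom-inverse c≈0)) ⟨
    geom c ⊗ (oneS ⊕ ⊝ c) ⊗ x        ≈⟨ *-assoc (geom c) (oneS ⊕ ⊝ c) x ⟩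
    geom c ⊗ ((oneS ⊕ ⊝ c) ⊗ x)      ≈⟨ *-congˡ {geom c} (oneS-⊝-⊗ c x) ⟩
    geom c ⊗ (x ⊕ ⊝ (c ⊗ x))         ≈⟨ *-congˡ {geom c} (+-congʳ {⊝ (c ⊗ x)} x≈cx+a) ⟩
    geom c ⊗ (c ⊗ x ⊕ a ⊕ ⊝ (c ⊗ x)) ≈⟨ *-congˡ {geom c} (xyx⁻¹≈y (c ⊗ x) a) ⟩
    geom c ⊗ a                       ∎
    where open ≈-Reasoning setoid

module Counting where

  open import Data.Bool using (Bool; true; false; _∧_; if_then_else_)
  open import Data.Bool.Properties using (∧-zeroʳ) renaming (_≟_ to _≟B_)
  open import Data.List using (List; []; _∷_; map; filter; length)
  open import Data.List.Properties using (length-++; filter-++)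
  open import Data.Nat using (_+_; _*_; _≡ᵇ_; _≤ᵇ_; _≤?_; _≟_)
  open import Data.Nat.Properties using (<⇒≤; m<n⇒m<1+n; <⇒≢; <⇒≱)
  open import Relation.Nullary.Decidable using (dec-true; dec-false)
  open ≡ using (refl; cong; cong₂)

  count : ℕ → (List Step → Bool) → ℕ
  count m P = length (filter (λ w → P w ≟B true) (words m))

  length-filter-map : ∀ {A B : Set} (P : B → Bool) (f : A → B) xs →
                      length (filter (λ y → P y ≟B true) (map f xs)) ≡ length (filter (λ x → P (f x) ≟B true) xs)
  length-filter-map P f []       = refl
  length-filter-map P f (x ∷ xs) with P (f x)
  ... | true  = cong suc (length-filter-map P f xs)
  ... | false = length-filter-map P f xs

  count-suc : ∀ m P → count (suc m) P ≡ count m (λ w → P (u ∷ w)) + count m (λ w → P (d ∷ w))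
  count-suc m P = ≡.trans (cong length (filter-++ P? (map (u ∷_) (words m)) _))
                    (≡.trans (length-++ (filter P? (map (u ∷_) (words m))))
                      (cong₂ _+_ (length-filter-map P (u ∷_) (words m)) (length-filter-map P (d ∷_) (words m))))
    where
    P? = λ w → P w ≟B true

  count-zero : ∀ P → count 0 P ≡ (if P [] then 1 else 0)
  count-zero P with P []
  ... | true  = refl
  ... | false = refl

  count-cong : ∀ m {P Q} → (∀ w → P w ≡ Q w) → count m P ≡ count m Q
  count-cong zero    {P} {Q} P≡Q =
    ≡.trans (count-zero P) (≡.trans (cong (if_then 1 else 0) (P≡Q [])) (≡.sym (count-zero Q)))
  count-cong (suc m) {P} {Q} P≡Q = ≡.trans (count-suc m P)
    (≡.trans (cong₂ _+_ (count-cong m (λ w → P≡Q (u ∷ w))) (count-cong m (λ w → P≡Q (d ∷ w)))) (≡.sym (count-suc m Q)))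

  count-none : ∀ m {P} → (∀ w → length w ≡ m → P w ≡ false) → count m P ≡ 0
  count-none zero    {P} none = ≡.trans (count-zero P) (cong (if_then 1 else 0) (none [] refl))
  count-none (suc m) {P} none = ≡.trans (count-suc m P)
    (cong₂ _+_ (count-none m (λ w eq → none (u ∷ w) (cong suc eq))) (count-none m (λ w eq → none (d ∷ w) (cong suc eq))))

  -- w completes a path whose last peak has height p (0 if there is none yet) and which
  -- currently stands at height h, creating k further pairs of equal consecutive peaks.
  completes : ℕ → ℕ → ℕ → List Step → Bool
  completes p h k w = (dyckFrom h w ∧ weaklyIncreasing (p ∷ peaksFrom h w)) ∧ (equalConsecutive (p ∷ peaksFrom h w) ≡ᵇ k)

  completions : ℕ → ℕ → ℕ → ℕ → ℕ
  completions p h m k = count m (completes p h k)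

  upCompletions : ℕ → ℕ → ℕ → ℕ → ℕ
  upCompletions p h m k = count m (λ w → completes p h k (u ∷ w))

  ≤ᵇ-true : ∀ {m n} → m ≤ n → (m ≤ᵇ n) ≡ true
  ≤ᵇ-true {m} {n} = dec-true (m ≤? n)

  ≤ᵇ-false : ∀ {m n} → n < m → (m ≤ᵇ n) ≡ false
  ≤ᵇ-false {m} {n} n<m = dec-false (m ≤? n) (<⇒≱ n<m)

  ≡ᵇ-true : ∀ n → (n ≡ᵇ n) ≡ true
  ≡ᵇ-true n = dec-true (n ≟ n) refl

  ≡ᵇ-false : ∀ {m n} → m < n → (m ≡ᵇ n) ≡ false
  ≡ᵇ-false {m} {n} m<n = dec-false (m ≟ n) (<⇒≢ m<n)

  dyckFrom-short : ∀ {h} w → length w < h → dyckFrom h w ≡ false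
  dyckFrom-short {suc h} []      _              = refl
  dyckFrom-short         (u ∷ w) 1+|w|<h        = dyckFrom-short w (m<n⇒m<1+n (<⇒≤ 1+|w|<h))
  dyckFrom-short {suc h} (d ∷ w) (s≤s 1+|w|≤h) = dyckFrom-short w 1+|w|≤h

  completes-peak-above : ∀ {p h} k w → p ≤ h → completes p h k (u ∷ d ∷ w) ≡ completes (suc h) h k w
  completes-peak-above {p} {h} k w p≤h
    rewrite ≤ᵇ-true (m≤n⇒m≤1+n p≤h) | ≡ᵇ-false (s≤s p≤h) = refl

  completes-peak-at : ∀ {h} k w → completes (suc h) h (suc k) (u ∷ d ∷ w) ≡ completes (suc h) h k w
  completes-peak-at {h} k w rewrite ≤ᵇ-true (≤-refl {suc h}) | ≡ᵇ-true h = refl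

  completes-peak-at-zero : ∀ {h} w → completes (suc h) h 0 (u ∷ d ∷ w) ≡ false
  completes-peak-at-zero {h} w rewrite ≤ᵇ-true (≤-refl {suc h}) | ≡ᵇ-true h = ∧-zeroʳ _

  completes-peak-below : ∀ {p h} k w → suc h < p → completes p h k (u ∷ d ∷ w) ≡ false
  completes-peak-below {p} {h} k w 1+h<p rewrite ≤ᵇ-false 1+h<p | ∧-zeroʳ (dyckFrom h w) = refl

  -- A peak reached from height h has height > h, so a last peak of height p ≤ h imposes nothing.
  completes-up-irrelevant : ∀ {p h} k w → p ≤ h → completes p h k (u ∷ w) ≡ completes 0 h k (u ∷ w)
  completes-up-irrelevant k []          p≤h = refl
  completes-up-irrelevant k (d ∷ w)     p≤h = ≡.trans (completes-peak-above k w p≤h) (≡.sym (completes-peak-above k w z≤n))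
  completes-up-irrelevant k (u ∷ w)     p≤h = completes-up-irrelevant k w (m≤n⇒m≤1+n p≤h)

  -- Every peak has positive height, so a leading 0 changes neither peak statistic.
  prepend-zero-peaks : ∀ {h} k b w →
    (b ∧ weaklyIncreasing (0 ∷ peaksFrom h w)) ∧ (equalConsecutive (0 ∷ peaksFrom h w) ≡ᵇ k)
      ≡ (b ∧ weaklyIncreasing (peaksFrom h w)) ∧ (equalConsecutive (peaksFrom h w) ≡ᵇ k)
  prepend-zero-peaks     k b []            = refl
  prepend-zero-peaks     k b (u ∷ [])      = refl
  prepend-zero-peaks     k b (u ∷ d ∷ w)   = refl
  prepend-zero-peaks {h} k b (u ∷ u ∷ w)   = prepend-zero-peaks {suc h} k b (u ∷ w)
  prepend-zero-peaks {h} k b (d ∷ w)       = prepend-zero-peaks {h ∸ 1} k b w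

  lhsCoeff≡completions : ∀ n k → lhsCoeff n k ≡ completions 0 0 (2 * n) k
  lhsCoeff≡completions n k = count-cong (2 * n) (λ w → ≡.sym (prepend-zero-peaks k (isDyck w) w))


module GeneratingFunctions where

  open BivariateSeries using (zeroSer; module ℤ⟦s⟧)
  open SeriesLemmas
  open Counting
  open import Data.Bool using (false)
  open import Data.List using (_∷_; length)
  open import Data.Integer using (_+_)
  import Data.Integer.Properties as ℤ
  open import Data.Nat using (_*_) renaming (_+_ to _+ℕ_)
  import Data.Nat.Properties as ℕ
  open ≡ using (cong)

  twice : ℕ → ℕ
  twice zero    = 0
  twice (suc n) = suc (suc (twice n))

  twice≡2* : ∀ n → twice n ≡ 2 * n
  twice≡2* zero    = ≡.refl
  twice≡2* (suc n) = cong suc (≡.trans (cong suc (twice≡2* n)) (≡.sym (ℕ.+-suc n (n +ℕ 0))))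

  -- A completion from height h has h + 2n steps, n of them up; z marks n and s marks k.
  -- B counts the completions starting with an up step, which z does not mark.
  A : ℕ → ℕ → Ser
  A p h n k = + completions p h (h +ℕ twice n) k

  B : ℕ → ℕ → Ser
  B p h n k = + upCompletions p h (suc h +ℕ twice n) k

  peak : ℕ → ℕ → Ser
  peak p h n k = + count (h +ℕ twice n) (λ w → completes p h k (u ∷ d ∷ w))

  completions-zero-suc : ∀ p m k → completions p 0 (suc m) k ≡ upCompletions p 0 m k
  completions-zero-suc p m k =
    ≡.trans (count-suc m (completes p 0 k)) (≡.trans (cong (upCompletions p 0 m k +ℕ_) (count-none m (λ _ _ → ≡.refl))) (ℕ.+-identityʳ _))

  completions-suc : ∀ p h m k → completions p (suc h) (suc m) k ≡ upCompletions p (suc h) m k +ℕ completions p h m k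
  completions-suc p h m k = count-suc m (completes p (suc h) k)

  upCompletions-suc : ∀ p h m k →
    upCompletions p h (suc m) k ≡ upCompletions p (suc h) m k +ℕ count m (λ w → completes p h k (u ∷ d ∷ w))
  upCompletions-suc p h m k = count-suc m (λ w → completes p h k (u ∷ w))

  upCompletions-short : ∀ p h k → upCompletions p (suc h) h k ≡ 0
  upCompletions-short p h k = count-none h short
    where
    short : ∀ w → length w ≡ h → completes p (suc h) k (u ∷ w) ≡ false
    short w |w|≡h rewrite dyckFrom-short {suc (suc h)} w (s≤s (ℕ.≤-trans (ℕ.≤-reflexive |w|≡h) (ℕ.n≤1+n h))) = ≡.refl

  upCompletions≡shift-B : ∀ p h n k → + upCompletions p (suc h) (h +ℕ twice n) k ≡ shift (B p (suc h)) n k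
  upCompletions≡shift-B p h zero    k = cong +_ (≡.trans (cong (λ m → upCompletions p (suc h) m k) (ℕ.+-identityʳ h)) (upCompletions-short p h k))
  upCompletions≡shift-B p h (suc n) k = cong (λ m → + upCompletions p (suc h) m k) (≡.trans (ℕ.+-suc h _) (cong suc (ℕ.+-suc h _)))

  A-zero : ∀ p → A p 0 ≈ oneS ⊕ zS ⊗ B p 0
  A-zero p = trans split (+-congˡ {oneS} (sym (zS-⊗ (B p 0))))
    where
    split : A p 0 ≈ oneS ⊕ shift (B p 0)
    split zero    zero    = ≡.refl
    split zero    (suc k) = ≡.refl
    split (suc n) k       = ≡.trans (cong +_ (completions-zero-suc p (suc (twice n)) k)) (≡.sym (ℤ.+-identityˡ _))

  A-suc : ∀ p h → A p (suc h) ≈ zS ⊗ B p (suc h) ⊕ A p h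
  A-suc p h = trans split (+-congʳ {A p h} (sym (zS-⊗ (B p (suc h)))))
    where
    split : A p (suc h) ≈ shift (B p (suc h)) ⊕ A p h
    split n k = ≡.trans (cong +_ (completions-suc p h (h +ℕ twice n) k))
                  (≡.trans (ℤ.pos-+ (upCompletions p (suc h) (h +ℕ twice n) k) _) (cong (_+ A p h n k) (upCompletions≡shift-B p h n k)))

  B-step : ∀ p h → B p h ≈ zS ⊗ B p (suc h) ⊕ peak p h
  B-step p h = trans split (+-congʳ {peak p h} (sym (zS-⊗ (B p (suc h)))))
    where
    split : B p h ≈ shift (B p (suc h)) ⊕ peak p h
    split n k = ≡.trans (cong +_ (upCompletions-suc p h (h +ℕ twice n) k))
                  (≡.trans (ℤ.pos-+ (upCompletions p (suc h) (h +ℕ twice n) k) _) (cong (_+ peak p h n k) (upCompletions≡shift-B p h n k)))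

  B-peak-above : ∀ {p h} → p ≤ h → B p h ≈ zS ⊗ B p (suc h) ⊕ A (suc h) h
  B-peak-above {p} {h} p≤h = trans (B-step p h) (+-congˡ {zS ⊗ B p (suc h)} above)
    where
    above : peak p h ≈ A (suc h) h
    above n k = cong +_ (count-cong (h +ℕ twice n) (λ w → completes-peak-above k w p≤h))

  B-peak-at : ∀ h → B (suc h) h ≈ zS ⊗ B (suc h) (suc h) ⊕ sS ⊗ A (suc h) h
  B-peak-at h = trans (B-step (suc h) h) (+-congˡ {zS ⊗ B (suc h) (suc h)} (trans at (sym (sS-⊗ (A (suc h) h)))))
    where
    at : peak (suc h) h ≈ λ n → ℤ⟦s⟧.shift (A (suc h) h n)
    at n zero    = cong +_ (count-none (h +ℕ twice n) (λ w _ → completes-peak-at-zero w))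
    at n (suc k) = cong +_ (count-cong (h +ℕ twice n) (λ w → completes-peak-at k w))

  B-peak-below : ∀ {p h} → suc h < p → B p h ≈ zS ⊗ B p (suc h)
  B-peak-below {p} {h} 1+h<p = trans (B-step p h) (trans (+-congˡ {zS ⊗ B p (suc h)} below) (+-identityʳ (zS ⊗ B p (suc h))))
    where
    below : peak p h ≈ zeroSer
    below n k = cong +_ (count-none (h +ℕ twice n) (λ w _ → completes-peak-below k w 1+h<p))

  B-irrelevant : ∀ {p h} → p ≤ h → B p h ≈ B 0 h
  B-irrelevant {h = h} p≤h n k = cong +_ (count-cong (suc h +ℕ twice n) (λ w → completes-up-irrelevant k w p≤h))

module Solution where

  open BivariateSeries using (zeroSer; serRing)
  open SeriesLemmas
  open GeneratingFunctions
  open import Data.Nat.Properties using (<⇒≤)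
  open import Algebra.Solver.Ring.NaturalCoefficients.Default (CommutativeRing.commutativeSemiring serRing)
    using (solve; _:+_; _:*_; _:=_)

  open import Data.Bool using (if_then_else_)
  open import Data.Nat using (_≡ᵇ_)
  open import Data.Integer using (0ℤ; _+_)

  afterPeak : ℕ → Ser
  afterPeak q = A (suc q) q

  B₀ : ℕ → Ser
  B₀ q = B 0 q

  A-below-peak : ∀ {q h} → h ≤ q → A (suc q) h ≈ oneS ⊕ zS ⊗ qint (suc h) ⊗ B (suc q) h
  A-below-peak {q} {zero}  _     =
    trans (A-zero (suc q)) (+-congˡ {oneS} (*-congʳ {B (suc q) 0} (sym (trans (*-congˡ {zS} qint-1) (*-identityʳ zS)))))
  A-below-peak {q} {suc h} 1+h≤q = begin
    A (suc q) (suc h)                                        ≈⟨ A-suc (suc q) h ⟩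
    zS ⊗ B′ ⊕ A (suc q) h                                    ≈⟨ +-congˡ {zS ⊗ B′} (A-below-peak (<⇒≤ 1+h≤q)) ⟩
    zS ⊗ B′ ⊕ (oneS ⊕ zS ⊗ qint (suc h) ⊗ B (suc q) h)      ≈⟨ +-congˡ {zS ⊗ B′} (+-congˡ {oneS} (*-congˡ {zS ⊗ qint (suc h)} (B-peak-below (s≤s 1+h≤q)))) ⟩
    zS ⊗ B′ ⊕ (oneS ⊕ zS ⊗ qint (suc h) ⊗ (zS ⊗ B′))       ≈⟨ regroup oneS zS B′ (qint (suc h)) ⟩
    oneS ⊕ (zS ⊕ zS ⊗ (zS ⊗ qint (suc h))) ⊗ B′             ≈⟨ +-congˡ {oneS} (*-congʳ {B′} (zS-⊗-qint-suc (suc h))) ⟨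
    oneS ⊕ zS ⊗ qint (suc (suc h)) ⊗ B′                      ∎
    where
    open ≈-Reasoning setoid
    B′ = B (suc q) (suc h)
    regroup : ∀ o z b q → z ⊗ b ⊕ (o ⊕ z ⊗ q ⊗ (z ⊗ b)) ≈ o ⊕ (z ⊕ z ⊗ (z ⊗ q)) ⊗ b
    regroup = solve 4 (λ o z b q → z :* b :+ (o :+ z :* q :* (z :* b)) := o :+ (z :+ z :* (z :* q)) :* b) refl

  afterPeak-eq : ∀ q → afterPeak q ≈ oneS ⊕ zS ⊗ qint (suc q) ⊗ (zS ⊗ B₀ (suc q) ⊕ sS ⊗ afterPeak q)
  afterPeak-eq q = trans (A-below-peak {q} {q} ≤-refl) (+-congˡ {oneS} (*-congˡ {zS ⊗ qint (suc q)}
    (trans (B-peak-at q) (+-congʳ {sS ⊗ afterPeak q} (*-congˡ {zS} (B-irrelevant {h = suc q} ≤-refl))))))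

  B₀-step : ∀ q → B₀ q ≈ zS ⊗ B₀ (suc q) ⊕ afterPeak q
  B₀-step q = B-peak-above {h = q} z≤n

  Y : ℕ → Ser
  Y q = powS zS (suc q) ⊗ B₀ q

  X : ℕ → Ser
  X q = powS zS (suc q) ⊗ afterPeak q

  weight : ℕ → Ser
  weight i = sS ⊗ zS ⊗ qint i

  weight-vanishes : ∀ i → VanishesBelow 1 (weight i)
  weight-vanishes i = ⊗-vanishesˡ (qint i) sS⊗zS-vanishes
    where
    sS⊗zS-vanishes : VanishesBelow 1 (sS ⊗ zS)
    sS⊗zS-vanishes (s≤s z≤n) zero    = sS-⊗ zS 0 0
    sS⊗zS-vanishes (s≤s z≤n) (suc k) = sS-⊗ zS 0 (suc k)

  Y-step : ∀ q → Y q ≈ X q ⊕ Y (suc q)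
  Y-step q = trans (*-congˡ {powS zS (suc q)} (B₀-step q)) (regroup (powS zS (suc q)) zS (B₀ (suc q)) (afterPeak q))
    where
    regroup : ∀ P z R Q → P ⊗ (z ⊗ R ⊕ Q) ≈ P ⊗ Q ⊕ z ⊗ P ⊗ R
    regroup = solve 4 (λ P z R Q → P :* (z :* R :+ Q) := P :* Q :+ z :* P :* R) refl

  X-eq : ∀ q → X q ≈ weight (suc q) ⊗ X q ⊕ (powS zS (suc q) ⊕ zS ⊗ qint (suc q) ⊗ Y (suc q))
  X-eq q = trans (*-congˡ {P} (afterPeak-eq q))
    (trans (regroup P oneS zS (qint (suc q)) (B₀ (suc q)) sS (afterPeak q))
      (+-congˡ {weight (suc q) ⊗ X q} (+-congʳ {zS ⊗ qint (suc q) ⊗ Y (suc q)} (*-identityʳ P))))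
    where
    P = powS zS (suc q)
    regroup : ∀ P o z q R s Q → P ⊗ (o ⊕ z ⊗ q ⊗ (z ⊗ R ⊕ s ⊗ Q)) ≈ s ⊗ z ⊗ q ⊗ (P ⊗ Q) ⊕ (P ⊗ o ⊕ z ⊗ q ⊗ (z ⊗ P ⊗ R))
    regroup = solve 7 (λ P o z q R s Q → P :* (o :+ z :* q :* (z :* R :+ s :* Q)) := s :* z :* q :* (P :* Q) :+ (P :* o :+ z :* q :* (z :* P :* R))) refl

  factor-eq : ∀ i → factor i ≈ oneS ⊕ zS ⊗ qint i ⊗ geom (weight i)
  factor-eq i = begin
    (oneS ⊕ (oneS ⊕ ⊝ sS) ⊗ zS ⊗ qint i) ⊗ G  ≈⟨ *-congʳ {G} (+-congˡ {oneS} numerator) ⟩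
    (oneS ⊕ (zq ⊕ ⊝ c)) ⊗ G                   ≈⟨ regroup oneS zq (⊝ c) G ⟩
    (oneS ⊕ ⊝ c) ⊗ G ⊕ zq ⊗ G                 ≈⟨ +-congʳ {zq ⊗ G} (geom-inverse (weight-vanishes i)) ⟩
    oneS ⊕ zq ⊗ G                             ∎
    where
    open ≈-Reasoning setoid
    zq = zS ⊗ qint i
    c = weight i
    G = geom c
    numerator : (oneS ⊕ ⊝ sS) ⊗ zS ⊗ qint i ≈ zq ⊕ ⊝ c
    numerator = trans (*-assoc (oneS ⊕ ⊝ sS) zS (qint i))
      (trans (oneS-⊝-⊗ sS zq) (+-congˡ {zq} (-‿cong (sym (*-assoc sS zS (qint i))))))
    regroup : ∀ o x n G → (o ⊕ (x ⊕ n)) ⊗ G ≈ (o ⊕ n) ⊗ G ⊕ x ⊗ G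
    regroup = solve 4 (λ o x n G → (o :+ (x :+ n)) :* G := (o :+ n) :* G :+ x :* G) refl

  Y-rec : ∀ q → Y q ≈ geom (weight (suc q)) ⊗ powS zS (suc q) ⊕ factor (suc q) ⊗ Y (suc q)
  Y-rec q = begin
    Y q                                            ≈⟨ Y-step q ⟩
    X q ⊕ Y′                                       ≈⟨ +-cong (linear-solution (weight-vanishes (suc q)) (X-eq q)) (sym (*-identityˡ Y′)) ⟩
    G ⊗ (P ⊕ zq ⊗ Y′) ⊕ oneS ⊗ Y′                  ≈⟨ regroup G P zq Y′ oneS ⟩
    G ⊗ P ⊕ (oneS ⊕ zq ⊗ G) ⊗ Y′                   ≈⟨ +-congˡ {G ⊗ P} (*-congʳ {Y′} (factor-eq (suc q))) ⟨
    G ⊗ P ⊕ factor (suc q) ⊗ Y′                    ∎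
    where
    open ≈-Reasoning setoid
    G = geom (weight (suc q))
    P = powS zS (suc q)
    zq = zS ⊗ qint (suc q)
    Y′ = Y (suc q)
    regroup : ∀ G P zq Y o → G ⊗ (P ⊕ zq ⊗ Y) ⊕ o ⊗ Y ≈ G ⊗ P ⊕ (o ⊕ zq ⊗ G) ⊗ Y
    regroup = solve 5 (λ G P zq Y o → G :* (P :+ zq :* Y) :+ o :* Y := G :* P :+ (o :+ zq :* G) :* Y) refl

  partialSum : ℕ → Ser
  partialSum zero    = zeroSer
  partialSum (suc N) = partialSum N ⊕ summand (suc N)

  Y-unroll : ∀ N → Y 0 ≈ partialSum N ⊕ prodFrom1 N factor ⊗ Y N
  Y-unroll zero    = sym (trans (+-identityˡ (oneS ⊗ Y 0)) (*-identityˡ (Y 0)))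
  Y-unroll (suc N) = trans (Y-unroll N) (trans (+-congˡ {partialSum N} (*-congˡ {Π} (Y-rec N)))
    (regroup (partialSum N) Π (geom (weight (suc N))) (powS zS (suc N)) (factor (suc N)) (Y (suc N))))
    where
    Π = prodFrom1 N factor
    regroup : ∀ S Π G P F Y → S ⊕ Π ⊗ (G ⊗ P ⊕ F ⊗ Y) ≈ (S ⊕ P ⊗ G ⊗ Π) ⊕ Π ⊗ F ⊗ Y
    regroup = solve 6 (λ S Π G P F Y → S :+ Π :* (G :* P :+ F :* Y) := (S :+ P :* G :* Π) :+ Π :* F :* Y) refl

  A-initial : ∀ N → A 0 0 ≈ oneS ⊕ (partialSum N ⊕ prodFrom1 N factor ⊗ Y N)
  A-initial N = trans (A-zero 0) (+-congˡ {oneS} (trans (*-congʳ {B₀ 0} (sym (*-identityʳ zS))) (Y-unroll N)))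

  remainder-vanishes : ∀ N → VanishesBelow (suc N) (prodFrom1 N factor ⊗ Y N)
  remainder-vanishes N {n} n≤N k =
    ≡.trans (swap (prodFrom1 N factor) (powS zS (suc N)) (B₀ N) n k)
      (⊗-vanishesˡ (prodFrom1 N factor ⊗ B₀ N) (powS-vanishes zS-vanishes (suc N)) n≤N k)
    where
    zS-vanishes : VanishesBelow 1 zS
    zS-vanishes (s≤s z≤n) k = ≡.refl
    swap : ∀ Π P R → Π ⊗ (P ⊗ R) ≈ P ⊗ (Π ⊗ R)
    swap = solve 3 (λ Π P R → Π :* (P :* R) := P :* (Π :* R)) refl

  partialSum-coefficient : ∀ N n k → partialSum N n k ≡ sumTo N (λ a → if a ≡ᵇ 0 then 0ℤ else summand a n k)
  partialSum-coefficient zero    n k = ≡.refl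
  partialSum-coefficient (suc N) n k = ≡.cong (_+ summand (suc N) n k) (partialSum-coefficient N n k)


mainTheorem15 : (n k : ℕ) → + lhsCoeff n k ≡ rhs n k
mainTheorem15 n k = begin
  + lhsCoeff n k                                                   ≡⟨ cong +_ (lhsCoeff≡completions n k) ⟩
  + completions 0 0 (2 * n) k                                      ≡⟨ cong (λ m → + completions 0 0 m k) (twice≡2* n) ⟨
  A 0 0 n k                                                        ≡⟨ A-initial n n k ⟩
  oneS n k + (partialSum n n k + (prodFrom1 n factor ⊗ Y n) n k)   ≡⟨ cong (λ t → oneS n k + (partialSum n n k + t)) (remainder-vanishes n ≤-refl k) ⟩
  oneS n k + (partialSum n n k + 0ℤ)                               ≡⟨ cong (λ t → oneS n k + t) (≡.trans (ℤ.+-identityʳ _) (partialSum-coefficient n n k)) ⟩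
  rhs n k                                                          ∎
  where
  open Counting using (completions; lhsCoeff≡completions)
  open GeneratingFunctions using (A; twice≡2*)
  open Solution
  open import Data.Nat using (_*_)
  open import Data.Integer using (0ℤ; _+_)
  import Data.Integer.Properties as ℤ
  open ≡ using (cong)
  open ≡.≡-Reasoning
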